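{- Let $T$ be a tree and let $e_a,e_b$ be distinct edges of $T$ with $\theta_T(e_a)=\theta_T(e_b)$. Then $e_a$ and $e_b$ repel.
   Context: For a finite tree $T$ and an edge $e$, $\theta_T(e)$ is the partition of $\#V(T)$ whose parts are the numbers of vertices of the two connected components of $(V(T),E(T)\setminus\{e\})$. The weight of a vertex $v$ of $T$ is the maximal number of edges in any subtree of $T$ containing $v$ as a leaf; the centroids of $T$ are the vertices of minimum weight. Two distinct edges $e_a,e_b$ of $T$ attract if there is a path in $T$ containing both $e_a$ and $e_b$ and having a centroid of $T$ as one endpoint; otherwise they repel. -}

module Defs where

open import Data.Nat using (ℕ; _≤_; suc)
open import Data.Fin using (Fin)
open import Data.Fin.Subset using (Subset; _∈_; _∉_; ⊤; ⁅_⁆; ∁; ∣_∣)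
open import Data.Product using (Σ; ∃; _×_; _,_; proj₁; proj₂)
open import Data.Sum using (_⊎_)
open import Data.List using (List; []; _∷_)
open import Data.List.Relation.Unary.Unique.Propositional using (Unique)
open import Data.Unit using () renaming (⊤ to Unit)
open import Data.Empty using (⊥)
open import Relation.Nullary using (¬_)
open import Relation.Binary.PropositionalEquality using (_≡_; _≢_)

Edges : ℕ → ℕ → Set
Edges n m = Fin m → Fin n × Fin n

SamePartition : ℕ → ℕ → ℕ → ℕ → Set
SamePartition p q p' q' = ((p ≡ p') × (q ≡ q')) ⊎ ((p ≡ q') × (q ≡ p'))

module _ {n m : ℕ} (E : Edges n m) where

  Joins : Fin m → Fin n → Fin n → Set
  Joins i x y = (E i ≡ (x , y)) ⊎ (E i ≡ (y , x))

  Adj : Fin n → Fin n → Set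
  Adj x y = ∃ λ i → Joins i x y

  Incident : Fin m → Fin n → Set
  Incident i v = (proj₁ (E i) ≡ v) ⊎ (proj₂ (E i) ≡ v)

  Simple : Set
  Simple = (∀ i → proj₁ (E i) ≢ proj₂ (E i))
         × (∀ i j x y → Joins i x y → Joins j x y → i ≡ j)

  data Walk (F : Subset m) : Fin n → Fin n → Set where
    here : ∀ {u} → Walk F u u
    step : ∀ {u x w} (i : Fin m) → i ∈ F → Joins i u x → Walk F x w → Walk F u w

  Connected : Set
  Connected = ∀ u w → Walk ⊤ u w

  Chain : List (Fin n) → Set
  Chain [] = Unit
  Chain (x ∷ []) = Unit
  Chain (x ∷ y ∷ r) = Adj x y × Chain (y ∷ r)

  lastOf : Fin n → List (Fin n) → Fin n
  lastOf x [] = x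
  lastOf x (y ∷ r) = lastOf y r

  IsCycle : List (Fin n) → Set
  IsCycle [] = ⊥
  IsCycle (x ∷ []) = ⊥
  IsCycle (x ∷ y ∷ []) = ⊥
  IsCycle (x ∷ y ∷ z ∷ r) =
    Unique (x ∷ y ∷ z ∷ r) × Chain (x ∷ y ∷ z ∷ r) × Adj (lastOf z r) x

  Acyclic : Set
  Acyclic = ∀ vs → ¬ IsCycle vs

  IsTree : Set
  IsTree = Simple × Connected × Acyclic

  CompSize : Subset m → Fin n → ℕ → Set
  CompSize F u k = Σ (Subset n) λ S → (∣ S ∣ ≡ k)
                   × (∀ w → (w ∈ S → Walk F u w) × (Walk F u w → w ∈ S))

  Theta : Fin m → ℕ → ℕ → Set
  Theta e p q = CompSize (∁ ⁅ e ⁆) (proj₁ (E e)) p × CompSize (∁ ⁅ e ⁆) (proj₂ (E e)) q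

  -- subtrees of T, given by their (nonempty) edge sets: the vertices touched by F
  -- are pairwise connected using edges of F (acyclicity is inherited from T)
  Touches : Subset m → Fin n → Set
  Touches F v = ∃ λ i → i ∈ F × Incident i v

  IsSubtree : Subset m → Set
  IsSubtree F = ∀ u w → Touches F u → Touches F w → Walk F u w

  LeafOf : Subset m → Fin n → Set
  LeafOf F v = ∃ λ i → i ∈ F × Incident i v × (∀ j → j ∈ F → Incident j v → j ≡ i)

  Weight : Fin n → ℕ → Set
  Weight v w = (∃ λ F → IsSubtree F × LeafOf F v × (∣ F ∣ ≡ w))
             × (∀ F → IsSubtree F → LeafOf F v → ∣ F ∣ ≤ w)

  IsCentroid : Fin n → Set
  IsCentroid c = ∃ λ wc → Weight c wc × (∀ v wv → Weight v wv → wc ≤ wv)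

  IsPath : List (Fin n) → Set
  IsPath vs = Unique vs × Chain vs

  UsesEdge : Fin m → List (Fin n) → Set
  UsesEdge e [] = ⊥
  UsesEdge e (x ∷ []) = ⊥
  UsesEdge e (x ∷ y ∷ r) = Joins e x y ⊎ UsesEdge e (y ∷ r)

  Attract : Fin m → Fin m → Set
  Attract ea eb = ∃ λ v0 → ∃ λ rest →
    IsPath (v0 ∷ rest) × UsesEdge ea (v0 ∷ rest) × UsesEdge eb (v0 ∷ rest)
    × (IsCentroid v0 ⊎ IsCentroid (lastOf v0 rest))

  Repel : Fin m → Fin m → Set
  Repel ea eb = ¬ Attract ea eb

module Submission where

-- Fix a root r.  For an edge e, the branch of r beyond e, Branch r e, is the set of
-- vertices separated from r by deleting e.  If e is crossed from α to β by a path
-- leaving r, the two components of T - e are the complement of Branch r e (around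
-- α) and Branch r e (around β), so θ_T(e) = {n - B, B} with B = ∣ Branch r e ∣.
--
-- Finally, if ea and eb lie
-- on a path starting at a centroid r, their branches are strictly nested, so equal
-- θ-partitions force B_a = n - B_b with B_b < B_a, i.e. 2 B_a > n, against the
-- centroid bound.

open import Defs
open import Data.Nat using (ℕ; zero; suc; _+_; _∸_; _≤_; _<_; z≤n; s≤s)
open import Data.Nat.Properties
  using (module ≤-Reasoning; ≤-refl; ≤-trans; ≤-antisym; ≤-reflexive; <⇒≤; ≰⇒>; ≤-<-trans; <-irrefl; _≤?_;
         m<n+o⇒m∸n<o; m+[n∸m]≡n; +-monoˡ-<)
open import Data.Fin using (Fin; zero; suc; _≟_)
open import Data.Fin.Properties using (0≢1+n; suc-injective)
open import Data.Fin.Subset using (Subset; ⁅_⁆; ∁; ∣_∣; _⊆_; _⊂_; _-_; inside; outside)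
  renaming (_∈_ to _∈ₛ_)
open import Data.Fin.Subset.Properties
  using (p⊆q⇒∣p∣≤∣q∣; p⊂q⇒∣p∣<∣q∣; ∣p∣≤n; ∣∁p∣≡n∸∣p∣; ⊆-antisym; x∈p∧x≢y⇒x∈p-y; x∈p⇒p-x⊂p;
         x∉⁅y⁆⇒x≢y; x≢y⇒x∉⁅y⁆; x∈∁p⇒x∉p; x∉p⇒x∈∁p)
open import Data.Product using (Σ; _×_; _,_; proj₁; proj₂)
open import Data.Sum using (_⊎_; inj₁; inj₂)
open import Data.Unit using (tt) renaming (⊤ to Unit)
open import Data.Empty using (⊥; ⊥-elim)
open import Data.List using (List; []; _∷_)
open import Data.List.Relation.Unary.Unique.Propositional using (Unique)
open import Data.List.Relation.Unary.AllPairs using ([]; _∷_)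
open import Data.List.Relation.Unary.All using ([]; _∷_)
import Data.List.Relation.Unary.All as All
open import Data.List.Relation.Unary.Any using (here; there)
open import Data.List.Membership.Propositional using () renaming (_∈_ to _∈ₗ_; _∉_ to _∉ₗ_)
open import Data.Vec using (tabulate; []; _∷_)
open import Data.Vec.Properties using (lookup∘tabulate; []=⇒lookup; lookup⇒[]=)
import Data.Vec.Base as Vec
open import Relation.Nullary using (¬_; Dec; yes; no; does)
open import Relation.Nullary.Decidable using (dec-true; ¬?)
open import Relation.Binary.PropositionalEquality using (_≡_; _≢_; refl; sym; trans; cong; subst; ≢-sym)

subsetOf : ∀ {k} {P : Fin k → Set} → (∀ v → Dec (P v)) → Subset k
subsetOf d = tabulate (λ v → does (d v))

∈-subsetOf⁻ : ∀ {k} {P : Fin k → Set} (d : ∀ v → Dec (P v)) {v} → v ∈ₛ subsetOf d → P v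
∈-subsetOf⁻ d {v} v∈ with d v | trans (sym (lookup∘tabulate (λ u → does (d u)) v)) ([]=⇒lookup v∈)
... | yes pv | _ = pv
... | no _   | ()

∈-subsetOf⁺ : ∀ {k} {P : Fin k → Set} (d : ∀ v → Dec (P v)) {v} → P v → v ∈ₛ subsetOf d
∈-subsetOf⁺ d {v} pv =
  lookup⇒[]= v _ (trans (lookup∘tabulate (λ u → does (d u)) v) (dec-true (d v) pv))

∣∣-injection : ∀ {a b} (f : Fin a → Fin b) (A : Subset a) (B : Subset b) →
  (∀ i → i ∈ₛ A → f i ∈ₛ B) → (∀ i j → i ∈ₛ A → j ∈ₛ A → f i ≡ f j → i ≡ j) → ∣ A ∣ ≤ ∣ B ∣
∣∣-injection f [] B into inj = z≤n
∣∣-injection f (outside ∷ A) B into inj =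
  ∣∣-injection (λ i → f (suc i)) A B (λ i i∈ → into (suc i) (Vec.there i∈))
    (λ i j i∈ j∈ eq → suc-injective (inj (suc i) (suc j) (Vec.there i∈) (Vec.there j∈) eq))
∣∣-injection f (inside ∷ A) B into inj =
  ≤-trans (s≤s (∣∣-injection (λ i → f (suc i)) A (B - f zero) intoRest injRest))
          (p⊂q⇒∣p∣<∣q∣ (x∈p⇒p-x⊂p (into zero Vec.here)))
  where
  intoRest : ∀ i → i ∈ₛ A → f (suc i) ∈ₛ B - f zero
  intoRest i i∈ = x∈p∧x≢y⇒x∈p-y (into (suc i) (Vec.there i∈))
    (λ eq → 0≢1+n (sym (inj (suc i) zero (Vec.there i∈) Vec.here eq)))
  injRest : ∀ i j → i ∈ₛ A → j ∈ₛ A → f (suc i) ≡ f (suc j) → i ≡ j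
  injRest i j i∈ j∈ eq = suc-injective (inj (suc i) (suc j) (Vec.there i∈) (Vec.there j∈) eq)

record Maximiser {k} (P : Fin k → Set) (f : Fin k → ℕ) : Set where
  constructor maximiser
  field
    point   : Fin k
    holds   : P point
    maximal : ∀ j → P j → f j ≤ f point

maximise : ∀ {k} (P : Fin k → Set) → (∀ i → Dec (P i)) → (f : Fin k → ℕ) →
           Maximiser P f ⊎ (∀ j → ¬ P j)
maximise {zero} P d f = inj₂ (λ ())
maximise {suc k} P d f with maximise (λ i → P (suc i)) (λ i → d (suc i)) (λ i → f (suc i)) | d zero
... | inj₂ none | no ¬p0 = inj₂ λ { zero → ¬p0 ; (suc j) → none j }
... | inj₂ none | yes p0 =
  inj₁ (maximiser zero p0 λ { zero _ → ≤-refl ; (suc j) pj → ⊥-elim (none j pj) })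
... | inj₁ (maximiser i pi max) | no ¬p0 =
  inj₁ (maximiser (suc i) pi λ { zero p0 → ⊥-elim (¬p0 p0) ; (suc j) pj → max j pj })
... | inj₁ (maximiser i pi max) | yes p0 with f zero ≤? f (suc i)
...   | yes le = inj₁ (maximiser (suc i) pi λ { zero _ → le ; (suc j) pj → max j pj })
...   | no gt  = inj₁ (maximiser zero p0 λ
                   { zero _ → ≤-refl ; (suc j) pj → ≤-trans (max j pj) (<⇒≤ (≰⇒>  gt)) })

samePartition-swapˡ : ∀ {p q a b} → SamePartition q p a b → SamePartition p q a b
samePartition-swapˡ (inj₁ (q≡a , p≡b)) = inj₂ (p≡b , q≡a)
samePartition-swapˡ (inj₂ (q≡b , p≡a)) = inj₁ (p≡a , q≡b)

samePartition-sym : ∀ {p q p' q'} → SamePartition p q p' q' → SamePartition p' q' p q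
samePartition-sym (inj₁ (a , b)) = inj₁ (sym a , sym b)
samePartition-sym (inj₂ (a , b)) = inj₂ (sym b , sym a)

samePartition-trans : ∀ {p q p' q' p'' q''} → SamePartition p q p' q' →
                      SamePartition p' q' p'' q'' → SamePartition p q p'' q''
samePartition-trans (inj₁ (refl , refl)) s = s
samePartition-trans (inj₂ (refl , refl)) s = samePartition-swapˡ s

unequal-halves : ∀ {n a b} → b < a → b ≤ n → SamePartition (n ∸ a) a (n ∸ b) b → n < a + a
unequal-halves b<a b≤n (inj₁ (_ , refl)) = ⊥-elim (<-irrefl refl b<a)
unequal-halves {n} {a} {b} b<a b≤n (inj₂ (_ , a≡n∸b)) =
  subst (_< a + a) (trans (cong (b +_) a≡n∸b) (m+[n∸m]≡n b≤n)) (+-monoˡ-< a b<a)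

less-than-half : ∀ n B → n < B + B → n ∸ B < B
less-than-half n zero ()
less-than-half n (suc B) lt = m<n+o⇒m∸n<o n (suc B) lt

module Walks {n m : ℕ} (E : Edges n m) where

  open import Data.List.Membership.DecPropositional (_≟_ {n}) using (_∈?_)

  X Y : Fin m → Fin n
  X i = proj₁ (E i)
  Y i = proj₂ (E i)

  data PWalk (P : Fin m → Set) : Fin n → Fin n → Set where
    nil  : ∀ {u} → PWalk P u u
    cons : ∀ {u x w} (i : Fin m) → P i → Joins E i u x → PWalk P x w → PWalk P u w

  _++_ : ∀ {P u v w} → PWalk P u v → PWalk P v w → PWalk P u w
  nil ++ V = V
  cons i p j W ++ V = cons i p j (W ++ V)

  joins-sym : ∀ {i a b} → Joins E i a b → Joins E i b a
  joins-sym (inj₁ e) = inj₂ e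
  joins-sym (inj₂ e) = inj₁ e

  reverse : ∀ {P u w} → PWalk P u w → PWalk P w u
  reverse nil = nil
  reverse (cons i p j W) = reverse W ++ cons i p (joins-sym j) nil

  weaken : ∀ {P Q : Fin m → Set} {u w} → (∀ i → P i → Q i) → PWalk P u w → PWalk Q u w
  weaken f nil = nil
  weaken f (cons i p j W) = cons i (f i p) j (weaken f W)

  -- the vertex sequence of a walk; written u ∷ ... so that it always reduces to a cons
  verticesAfter : ∀ {P u w} → PWalk P u w → List (Fin n)
  vertices : ∀ {P u w} → PWalk P u w → List (Fin n)
  vertices {u = u} W = u ∷ verticesAfter W
  verticesAfter nil = []
  verticesAfter (cons i p j W) = vertices W

  joins-ends : ∀ {i a b} → Joins E i a b → (a ≡ X i × b ≡ Y i) ⊎ (a ≡ Y i × b ≡ X i)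
  joins-ends (inj₁ e) = inj₁ (cong proj₁ (sym e) , cong proj₂ (sym e))
  joins-ends (inj₂ e) = inj₂ (cong proj₂ (sym e) , cong proj₁ (sym e))

  incident-joins : ∀ {i a b z} → Joins E i a b → Incident E i z → z ≡ a ⊎ z ≡ b
  incident-joins j inc with joins-ends j | inc
  ... | inj₁ (p , q) | inj₁ r = inj₁ (trans (sym r) (sym p))
  ... | inj₁ (p , q) | inj₂ r = inj₂ (trans (sym r) (sym q))
  ... | inj₂ (p , q) | inj₁ r = inj₂ (trans (sym r) (sym q))
  ... | inj₂ (p , q) | inj₂ r = inj₁ (trans (sym r) (sym p))

  joins-incidentˡ : ∀ {i a b} → Joins E i a b → Incident E i a
  joins-incidentˡ j with joins-ends j
  ... | inj₁ (p , _) = inj₁ (sym p)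
  ... | inj₂ (p , _) = inj₂ (sym p)

  joins-incidentʳ : ∀ {i a b} → Joins E i a b → Incident E i b
  joins-incidentʳ j = joins-incidentˡ (joins-sym j)

  incident-both : ∀ {i a b} → Incident E i a → Incident E i b → a ≢ b → Joins E i a b
  incident-both (inj₁ refl) (inj₂ refl) _ = inj₁ refl
  incident-both (inj₂ refl) (inj₁ refl) _ = inj₂ refl
  incident-both (inj₁ refl) (inj₁ q) a≢b = ⊥-elim (a≢b q)
  incident-both (inj₂ refl) (inj₂ q) a≢b = ⊥-elim (a≢b q)

  otherEnd : ∀ {i w} → Incident E i w → Σ (Fin n) λ a → Joins E i w a
  otherEnd (inj₁ refl) = _ , inj₁ refl
  otherEnd (inj₂ refl) = _ , inj₂ refl

  data Traverses {P} (e : Fin m) (a b : Fin n) : ∀ {u w} → PWalk P u w → Set where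
    now   : ∀ {w} {p : P e} {j : Joins E e a b} {W : PWalk P b w} → Traverses e a b (cons e p j W)
    later : ∀ {u x w i} {p : P i} {j : Joins E i u x} {W : PWalk P x w} →
            Traverses e a b W → Traverses e a b (cons i p j W)

  traversed : ∀ {P e a b u w} {W : PWalk P u w} → Traverses e a b W →
              Joins E e a b × a ∈ₗ vertices W × b ∈ₗ vertices W
  traversed (now {j = j} {W = nil}) = j , here refl , there (here refl)
  traversed (now {j = j} {W = cons _ _ _ _}) = j , here refl , there (here refl)
  traversed (later T) with traversed T
  ... | j , a∈ , b∈ = j , there a∈ , there b∈

  avoidVertex : ∀ {P u w e z} → Incident E e z → (W : PWalk P u w) → z ∉ₗ vertices W →
                PWalk (λ i → i ≢ e) u w
  avoidVertex inc nil z∉ = nil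
  avoidVertex {e = e} inc (cons i p j W) z∉ = cons i i≢e j (avoidVertex inc W (λ z∈ → z∉ (there z∈)))
    where
    i≢e : i ≢ e
    i≢e refl with incident-joins j inc
    ... | inj₁ refl = z∉ (here refl)
    ... | inj₂ refl = z∉ (there (here refl))

  splitAt : ∀ {P e a b u w} (W : PWalk P u w) → Unique (vertices W) → Traverses e a b W →
            PWalk (λ i → i ≢ e) u a × PWalk (λ i → i ≢ e) b w
  splitAt (cons e p j W) (a∉ ∷ _) now =
    nil , avoidVertex (joins-incidentˡ j) W (λ a∈ → All.lookup a∉ a∈ refl)
  splitAt {e = e} (cons i p j W) (u∉ ∷ uq) (later T) with splitAt W uq T | traversed T
  ... | before , after | je , a∈ , b∈ = cons i i≢e j before , after
    where
    i≢e : i ≢ e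
    i≢e refl with incident-joins je (joins-incidentˡ j)
    ... | inj₁ refl = All.lookup u∉ a∈ refl
    ... | inj₂ refl = All.lookup u∉ b∈ refl

  suffixFrom : ∀ {P u w z} (W : PWalk P u w) → Unique (vertices W) → z ∈ₗ vertices W →
               Σ (PWalk P z w) λ V → Unique (vertices V)
  suffixFrom W uq (here refl) = W , uq
  suffixFrom nil uq (there ())
  suffixFrom (cons i p j W) (_ ∷ uq) (there z∈) = suffixFrom W uq z∈

  toPath : ∀ {P u w} → PWalk P u w → Σ (PWalk P u w) λ V → Unique (vertices V)
  toPath nil = nil , [] ∷ []
  toPath {u = u} (cons i p j W) with toPath W
  ... | V , uq with u ∈? vertices V
  ... | yes u∈ = suffixFrom V uq u∈
  ... | no u∉ = cons i p j V , All.tabulate (λ y∈ u≡y → u∉ (subst (_∈ₗ vertices V) (sym u≡y) y∈)) ∷ uq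

  lastEdge : ∀ {P u w} → u ≢ w → (W : PWalk P u w) → Σ (Fin n) λ a → Σ (Fin m) λ h → Traverses h a w W
  lastEdge u≢w nil = ⊥-elim (u≢w refl)
  lastEdge _ (cons i p j W) = lastEdgeOfCons i p j W
    where
    lastEdgeOfCons : ∀ {P u x w} (i : Fin m) (p : P i) (j : Joins E i u x) (W : PWalk P x w) →
                     Σ (Fin n) λ a → Σ (Fin m) λ h → Traverses h a w (cons i p j W)
    lastEdgeOfCons i p j nil = _ , i , now
    lastEdgeOfCons i p j (cons i' p' j' W) with lastEdgeOfCons i' p' j' W
    ... | a , h , T = a , h , later T

  UntilEdge : (Fin m → Set) → Fin m → Fin n → Fin n → Set
  UntilEdge P g u v = PWalk (λ i → P i × i ≢ g) u v
                    ⊎ Σ (Fin n) λ z → Incident E g z × PWalk (λ i → P i × i ≢ g) u z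

  untilEdge : ∀ {P u v} g → PWalk P u v → UntilEdge P g u v
  untilEdge g nil = inj₁ nil
  untilEdge g (cons i p j W) with i ≟ g
  ... | yes refl = inj₂ (_ , joins-incidentˡ j , nil)
  ... | no i≢g with untilEdge g W
  ...   | inj₁ V = inj₁ (cons i (p , i≢g) j V)
  ...   | inj₂ (z , inc , V) = inj₂ (z , inc , cons i (p , i≢g) j V)

  fromWalk : ∀ {F u w} → Walk E F u w → PWalk (_∈ₛ F) u w
  fromWalk here = nil
  fromWalk (step i p j W) = cons i p j (fromWalk W)

  toWalk : ∀ {F u w} → PWalk (_∈ₛ F) u w → Walk E F u w
  toWalk nil = here
  toWalk (cons i p j W) = step i p j (toWalk W)

  chainOf : ∀ {P u w} (W : PWalk P u w) → Chain E (vertices W)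
  chainOf nil = tt
  chainOf (cons i p j W) = (i , j) , chainOf W

  lastOf-vertices : ∀ {P u w} (W : PWalk P u w) → lastOf E u (verticesAfter W) ≡ w
  lastOf-vertices nil = refl
  lastOf-vertices (cons i p j W) = lastOf-vertices W

  fromChain : ∀ v rest → Chain E (v ∷ rest) → PWalk (λ _ → Unit) v (lastOf E v rest)
  fromChain v [] _ = nil
  fromChain v (y ∷ rest) ((i , ji) , chain) = cons i tt ji (fromChain y rest chain)

  vertices-fromChain : ∀ v rest (chain : Chain E (v ∷ rest)) → vertices (fromChain v rest chain) ≡ v ∷ rest
  vertices-fromChain v [] _ = refl
  vertices-fromChain v (y ∷ rest) (_ , chain) = cong (v ∷_) (vertices-fromChain y rest chain)

module Tree {n m : ℕ} (E : Edges n m) (tree : IsTree E) where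

  open Walks E

  simple : Simple E
  simple = proj₁ tree

  connected : Connected E
  connected = proj₁ (proj₂ tree)

  acyclic : Acyclic E
  acyclic = proj₂ (proj₂ tree)

  Linked : Fin m → Fin n → Fin n → Set
  Linked e = PWalk (λ i → i ≢ e)

  edgeLink : ∀ {g i a b} → Joins E i a b → i ≢ g → Linked g a b
  edgeLink j i≢g = cons _ i≢g j nil

  -- No edge can be bypassed: a bypass, shortened to a path, would close a cycle
  -- with the edge (or be a loop or a parallel edge).
  noBypass : ∀ {g a b} → Joins E g a b → ¬ Linked g a b
  noBypass {g} jg W with toPath W
  ... | nil , _ with joins-ends jg
  ...   | inj₁ (p , q) = proj₁ simple g (trans (sym p) q)
  ...   | inj₂ (p , q) = proj₁ simple g (trans (sym q) p)
  noBypass {g} jg W | cons i i≢g j nil , _ = i≢g (proj₂ simple i g _ _ j jg)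
  noBypass {g} {a} jg W | V@(cons _ _ _ (cons _ _ _ V')) , uq =
    acyclic (vertices V)
      (uq , chainOf V , subst (λ z → Adj E z a) (sym (lastOf-vertices V')) (g , joins-sym jg))

  sideAlong : ∀ {P} g {v t} → PWalk P v t →
              Linked g t (X g) ⊎ Linked g t (Y g) → Linked g v (X g) ⊎ Linked g v (Y g)
  sideAlong g nil s = s
  sideAlong g (cons i p j W) s with i ≟ g | sideAlong g W s
  ... | no i≢g | inj₁ t = inj₁ (cons i i≢g j t)
  ... | no i≢g | inj₂ t = inj₂ (cons i i≢g j t)
  ... | yes refl | _ with joins-ends j
  ...   | inj₁ (refl , _) = inj₁ nil
  ...   | inj₂ (refl , _) = inj₂ nil

  side : ∀ g v → Linked g v (X g) ⊎ Linked g v (Y g)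
  side g v = sideAlong g (fromWalk (connected v (X g))) (inj₁ nil)

  twoSides : ∀ {e α β} → Joins E e α β → ∀ w → Linked e w α ⊎ Linked e w β
  twoSides {e} j w with side e w | joins-ends j
  ... | inj₁ s | inj₁ (refl , _) = inj₁ s
  ... | inj₁ s | inj₂ (_ , refl) = inj₂ s
  ... | inj₂ s | inj₁ (_ , refl) = inj₂ s
  ... | inj₂ s | inj₂ (refl , _) = inj₁ s

  -- hence T - g has exactly two components and linkage in it is decidable
  linked? : ∀ g a b → Dec (Linked g a b)
  linked? g a b with side g a | side g b
  ... | inj₁ sa | inj₁ sb = yes (sa ++ reverse sb)
  ... | inj₂ sa | inj₂ sb = yes (sa ++ reverse sb)
  ... | inj₁ sa | inj₂ sb = no λ W → noBypass (inj₁ refl) (reverse sa ++ (W ++ sb))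
  ... | inj₂ sa | inj₁ sb = no λ W → noBypass (inj₁ refl) (reverse sb ++ (reverse W ++ sa))

  unlinked⇒≢ : ∀ {g a b} → ¬ Linked g a b → b ≢ a
  unlinked⇒≢ ¬ab refl = ¬ab nil

  sameEnd : ∀ {g a b} → Incident E g a → Incident E g b → Linked g a b → a ≡ b
  sameEnd (inj₁ p) (inj₁ q) _ = trans (sym p) q
  sameEnd (inj₂ p) (inj₂ q) _ = trans (sym p) q
  sameEnd (inj₁ refl) (inj₂ refl) W = ⊥-elim (noBypass (inj₁ refl) W)
  sameEnd (inj₂ refl) (inj₁ refl) W = ⊥-elim (noBypass (inj₁ refl) (reverse W))

  IsFarEnd : Fin n → Fin m → Fin n → Set
  IsFarEnd r g z = Incident E g z × ¬ Linked g r z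

  farEnd-exists : ∀ r g → Σ (Fin n) (IsFarEnd r g)
  farEnd-exists r g with side g r
  ... | inj₁ s = Y g , inj₂ refl , λ W → noBypass (inj₁ refl) (reverse s ++ W)
  ... | inj₂ s = X g , inj₁ refl , λ W → noBypass (inj₁ refl) (reverse W ++ s)

  farEnd : Fin n → Fin m → Fin n
  farEnd r g = proj₁ (farEnd-exists r g)

  farEnd-isFar : ∀ r g → IsFarEnd r g (farEnd r g)
  farEnd-isFar r g = proj₂ (farEnd-exists r g)

  farEnd-unique : ∀ {r g z z'} → IsFarEnd r g z → IsFarEnd r g z' → z ≡ z'
  farEnd-unique {r} {g} (iz , ¬z) (iz' , ¬z') with iz | iz'
  ... | inj₁ p | inj₁ q = trans (sym p) q
  ... | inj₂ p | inj₂ q = trans (sym p) q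
  ... | inj₁ refl | inj₂ refl with side g r
  ...   | inj₁ s = ⊥-elim (¬z s)
  ...   | inj₂ s = ⊥-elim (¬z' s)
  farEnd-unique {r} {g} (iz , ¬z) (iz' , ¬z') | inj₂ refl | inj₁ refl with side g r
  ...   | inj₁ s = ⊥-elim (¬z' s)
  ...   | inj₂ s = ⊥-elim (¬z s)

  nearEnd : ∀ {r g a b} → Joins E g a b → IsFarEnd r g b → Linked g r a
  nearEnd {r} {g} j (_ , ¬b) with side g r | joins-ends j
  ... | inj₁ s | inj₁ (refl , _) = s
  ... | inj₁ s | inj₂ (_ , refl) = ⊥-elim (¬b s)
  ... | inj₂ s | inj₂ (refl , _) = s
  ... | inj₂ s | inj₁ (_ , refl) = ⊥-elim (¬b s)

  -- Otherwise let w be far for g and g',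
  -- and walk from the near end b of g' to r in T - g' until g is met: we either link
  -- r to w avoiding g, or bypass g', or link r to w avoiding g'.
  farEnd-injective : ∀ {r g g' w} → g ≢ g' → IsFarEnd r g w → IsFarEnd r g' w → ⊥
  farEnd-injective {r} {g} {g'} g≢g' far far' with otherEnd (proj₁ far) | otherEnd (proj₁ far')
  ... | a , ja | b , jb with untilEdge g (reverse (nearEnd (joins-sym jb) far'))
  ... | inj₁ V = proj₂ far (reverse (weaken (λ _ → proj₂) V) ++ edgeLink (joins-sym jb) (≢-sym g≢g'))
  ... | inj₂ (z , iz , V) with incident-joins ja iz
  ...   | inj₁ refl = noBypass (joins-sym jb) (weaken (λ _ → proj₁) V)
  ...   | inj₂ refl = proj₂ far'
          (nearEnd (joins-sym jb) far' ++ (weaken (λ _ → proj₁) V ++ edgeLink (joins-sym ja) g≢g'))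

  firstEdgeFar : ∀ {P r g v x} (j : Joins E g v x) (R : PWalk P x r) → Unique (v ∷ vertices R) →
                 IsFarEnd r g v
  firstEdgeFar j R (v∉ ∷ _) =
    joins-incidentˡ j ,
    λ W → noBypass (joins-sym j) (avoidVertex (joins-incidentˡ j) R (λ v∈ → All.lookup v∉ v∈ refl) ++ W)

  farEnd-surjective : ∀ {r w} → w ≢ r → Σ (Fin m) λ g → IsFarEnd r g w
  farEnd-surjective {r} {w} w≢r with toPath (fromWalk (connected w r))
  ... | nil , _ = ⊥-elim (w≢r refl)
  ... | cons g _ j R , uq = g , firstEdgeFar j R uq

-- For an edge h at r, the vertex r together with Branch r h spans a subtree
-- whose edges are those with far endpoint in Branch r h; it is the largest subtree
-- with r as a leaf through h.  Hence the weight of r is the largest ∣ Branch r h ∣.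
module Branches {n m : ℕ} (E : Edges n m) (tree : IsTree E) where

  open Walks E
  open Tree E tree

  Branch : Fin n → Fin m → Subset n
  Branch r e = subsetOf (λ v → ¬? (linked? e r v))

  ∈-branch⁻ : ∀ {r e v} → v ∈ₛ Branch r e → ¬ Linked e r v
  ∈-branch⁻ {r} {e} = ∈-subsetOf⁻ (λ v → ¬? (linked? e r v))

  ∈-branch⁺ : ∀ {r e v} → ¬ Linked e r v → v ∈ₛ Branch r e
  ∈-branch⁺ {r} {e} = ∈-subsetOf⁺ (λ v → ¬? (linked? e r v))

  BranchEdges : Fin n → Fin m → Subset m
  BranchEdges r h = subsetOf (λ g → ¬? (linked? h r (farEnd r g)))

  ∈-branchEdges⁻ : ∀ {r h g} → g ∈ₛ BranchEdges r h → ¬ Linked h r (farEnd r g)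
  ∈-branchEdges⁻ {r} {h} = ∈-subsetOf⁻ (λ g → ¬? (linked? h r (farEnd r g)))

  ∈-branchEdges⁺ : ∀ {r h g} → ¬ Linked h r (farEnd r g) → g ∈ₛ BranchEdges r h
  ∈-branchEdges⁺ {r} {h} = ∈-subsetOf⁺ (λ g → ¬? (linked? h r (farEnd r g)))

  far⇒∈-branchEdges : ∀ {r h g z} → IsFarEnd r g z → ¬ Linked h r z → g ∈ₛ BranchEdges r h
  far⇒∈-branchEdges {r} {h} {g} far ¬z =
    ∈-branchEdges⁺ (subst (λ y → ¬ Linked h r y) (sym (farEnd-unique (farEnd-isFar r g) far)) ¬z)

  -- g ↦ farEnd r g is a bijection from BranchEdges r h onto Branch r h
  ∣branchEdges∣ : ∀ r h → ∣ BranchEdges r h ∣ ≡ ∣ Branch r h ∣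
  ∣branchEdges∣ r h = ≤-antisym
    (∣∣-injection (farEnd r) (BranchEdges r h) (Branch r h)
      (λ g g∈ → ∈-branch⁺ (∈-branchEdges⁻ g∈)) (λ g g' _ _ → farEnd-injective'))
    (∣∣-injection edgeTo (Branch r h) (BranchEdges r h)
      (λ w w∈ → far⇒∈-branchEdges (edgeTo-far w∈) (∈-branch⁻ w∈))
      (λ w w' w∈ w'∈ eq → farEnd-unique (subst (λ g → IsFarEnd r g w) eq (edgeTo-far w∈)) (edgeTo-far w'∈)))
    where
    farEnd-injective' : ∀ {g g'} → farEnd r g ≡ farEnd r g' → g ≡ g'
    farEnd-injective' {g} {g'} eq with g ≟ g'
    ... | yes g≡g' = g≡g'
    ... | no g≢g' = ⊥-elim (farEnd-injective g≢g' (farEnd-isFar r g)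
                                (subst (IsFarEnd r g') (sym eq) (farEnd-isFar r g')))
    -- the edge whose far endpoint is w (an arbitrary edge when w = r)
    edgeTo : Fin n → Fin m
    edgeTo w with w ≟ r
    ... | yes _ = h
    ... | no w≢r = proj₁ (farEnd-surjective w≢r)
    edgeTo-far : ∀ {w} → w ∈ₛ Branch r h → IsFarEnd r (edgeTo w) w
    edgeTo-far {w} w∈ with w ≟ r
    ... | yes w≡r = ⊥-elim (unlinked⇒≢ (∈-branch⁻ w∈) w≡r)
    ... | no w≢r = proj₂ (farEnd-surjective w≢r)

  InClosedBranch : Fin n → Fin m → Fin n → Set
  InClosedBranch r h v = v ≡ r ⊎ ¬ Linked h r v

  leaveBranch : ∀ {r h g v x} → Incident E h r → Joins E g v x → ¬ Linked h r v → Linked h r x → x ≡ r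
  leaveBranch {h = h} {g} ihr j ¬v x~ with g ≟ h
  ... | no g≢h = ⊥-elim (¬v (x~ ++ reverse (edgeLink j g≢h)))
  ... | yes refl with incident-joins j ihr
  ...   | inj₁ refl = ⊥-elim (¬v nil)
  ...   | inj₂ x≡r = sym x≡r

  pathHome : ∀ {P r h v} → Incident E h r → (W : PWalk P v r) → Unique (vertices W) → ¬ Linked h r v →
             PWalk (_∈ₛ BranchEdges r h) v r
  pathHome ihr nil _ _ = nil
  pathHome {r = r} {h} ihr (cons {x = x} g _ j R) uq@(_ ∷ uqR) ¬v = cons g g∈ j (rest (linked? h r x))
    where
    g∈ : g ∈ₛ BranchEdges r h
    g∈ = far⇒∈-branchEdges (firstEdgeFar j R uq) ¬v
    rest : Dec (Linked h r x) → PWalk (_∈ₛ BranchEdges r h) x r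
    rest (no ¬x) = pathHome ihr R uqR ¬x
    rest (yes x~) = subst (λ y → PWalk (_∈ₛ BranchEdges r h) y r) (sym (leaveBranch ihr j ¬v x~)) nil

  toRoot : ∀ {r h v} → Incident E h r → InClosedBranch r h v → PWalk (_∈ₛ BranchEdges r h) v r
  toRoot ihr (inj₁ refl) = nil
  toRoot {r} {h} {v} ihr (inj₂ ¬v) with toPath (fromWalk (connected v r))
  ... | W , uq = pathHome ihr W uq ¬v

  touched-inClosedBranch : ∀ {r h v} → Incident E h r → Touches E (BranchEdges r h) v → InClosedBranch r h v
  touched-inClosedBranch {r} {h} {v} ihr (g , g∈ , iv) with linked? g r v
  ... | no ¬v = inj₂ (subst (λ y → ¬ Linked h r y) (farEnd-unique (farEnd-isFar r g) (iv , ¬v)) (∈-branchEdges⁻ g∈))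
  ... | yes v~ with g ≟ h
  ...   | yes refl = inj₁ (sym (sameEnd ihr iv v~))
  ...   | no g≢h = inj₂ λ W → ∈-branchEdges⁻ g∈ (W ++ edgeLink vFar g≢h)
    where
    vFar : Joins E g v (farEnd r g)
    vFar = incident-both iv (proj₁ (farEnd-isFar r g)) (λ e → proj₂ (farEnd-isFar r g) (subst (Linked g r) e v~))

  -- BranchEdges r h is a subtree (all its vertices are joined through r) ...
  branchEdges-subtree : ∀ {r h} → Incident E h r → IsSubtree E (BranchEdges r h)
  branchEdges-subtree ihr u w tu tw =
    toWalk (toRoot ihr (touched-inClosedBranch ihr tu) ++ reverse (toRoot ihr (touched-inClosedBranch ihr tw)))

  branchEdges-leaf : ∀ {r h} → Incident E h r → LeafOf E (BranchEdges r h) r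
  branchEdges-leaf {r} {h} ihr = h , ∈-branchEdges⁺ (proj₂ (farEnd-isFar r h)) , ihr , onlyH
    where
    -- another edge g at r has r as its near end, and r is linked to itself
    onlyH : ∀ g → g ∈ₛ BranchEdges r h → Incident E g r → g ≡ h
    onlyH g g∈ igr with g ≟ h
    ... | yes g≡h = g≡h
    ... | no g≢h = ⊥-elim (∈-branchEdges⁻ g∈ (edgeLink rFar g≢h))
      where
      rFar : Joins E g r (farEnd r g)
      rFar = incident-both igr (proj₁ (farEnd-isFar r g)) (≢-sym (unlinked⇒≢ (proj₂ (farEnd-isFar r g))))

  -- a subtree F with r as a leaf through h lies inside BranchEdges r h: walking in F
  -- from the far end of h, one stays in the closed branch
  branchEdges-maximal : ∀ {r} F → IsSubtree E F → (leaf : LeafOf E F r) → F ⊆ BranchEdges r (proj₁ leaf)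
  branchEdges-maximal {r} F subtree (h , h∈ , ihr , onlyH) {g} g∈
    with stays (fromWalk (subtree _ _ (h , h∈ , proj₁ (farEnd-isFar r h)) (g , g∈ , proj₁ (farEnd-isFar r g))))
               (inj₂ (proj₂ (farEnd-isFar r h)))
    where
    stays : ∀ {a z} → PWalk (_∈ₛ F) a z → InClosedBranch r h a → InClosedBranch r h z
    stays nil ia = ia
    stays (cons i i∈ j R) (inj₁ refl) with onlyH i i∈ (joins-incidentˡ j)
    ... | refl = stays R (inj₂ (noBypass j))
    stays (cons i i∈ j R) (inj₂ ¬a) with i ≟ h
    ... | no i≢h = stays R (inj₂ λ W → ¬a (W ++ reverse (edgeLink j i≢h)))
    ... | yes refl with incident-joins j ihr
    ...   | inj₁ refl = ⊥-elim (¬a nil)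
    ...   | inj₂ refl = stays R (inj₁ refl)
  ... | inj₁ far≡r = ⊥-elim (unlinked⇒≢ (proj₂ (farEnd-isFar r g)) far≡r)
  ... | inj₂ ¬far = ∈-branchEdges⁺ ¬far

  weight-attained : ∀ y h₀ → Incident E h₀ y → Σ (Fin m) λ h → Incident E h y × Weight E y ∣ Branch y h ∣
  weight-attained y h₀ ih₀ with maximise (λ h → Incident E h y) incident? (λ h → ∣ Branch y h ∣)
    where
    incident? : ∀ h → Dec (Incident E h y)
    incident? h with X h ≟ y | Y h ≟ y
    ... | yes p | _     = yes (inj₁ p)
    ... | no _  | yes q = yes (inj₂ q)
    ... | no p  | no q  = no λ { (inj₁ a) → p a ; (inj₂ b) → q b }
  ... | inj₂ none = ⊥-elim (none h₀ ih₀)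
  ... | inj₁ (maximiser h ih max) =
    h , ih , ((BranchEdges y h , branchEdges-subtree ih , branchEdges-leaf ih , ∣branchEdges∣ y h) ,
      λ F subtree leaf → ≤-trans (p⊆q⇒∣p∣≤∣q∣ (branchEdges-maximal F subtree leaf))
        (≤-trans (≤-reflexive (∣branchEdges∣ y (proj₁ leaf))) (max (proj₁ leaf) (proj₁ (proj₂ (proj₂ leaf))))))

  branch≤weight : ∀ {r h w} → Weight E r w → Incident E h r → ∣ Branch r h ∣ ≤ w
  branch≤weight {r} {h} (_ , bounded) ihr =
    subst (_≤ _) (∣branchEdges∣ r h) (bounded (BranchEdges r h) (branchEdges-subtree ihr) (branchEdges-leaf ihr))

-- The centroid bound: if r is a centroid then 2 ∣ Branch r e ∣ ≤ n for every edge e.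
-- Otherwise, with e crossed from α to β going away from r, every branch at β is smaller
-- than ∣ Branch r e ∣ while a branch at r contains Branch r e, so β is lighter than r.
module CentroidBound {n m : ℕ} (E : Edges n m) (tree : IsTree E) where

  open Walks E
  open Tree E tree
  open Branches E tree

  rootBranchAbove : ∀ {r e α β} → Joins E e α β → Linked e r α →
                    Σ (Fin m) λ h → Incident E h r × Branch r e ⊆ Branch r h
  rootBranchAbove {r} {e} {α} {β} j r~α with toPath (fromWalk (connected β r))
  ... | W , uq with lastEdge (unlinked⇒≢ (λ r~β → noBypass j (reverse r~α ++ r~β))) W
  ... | a , h , T with splitAt W uq T | traversed T
  ... | β~a , _ | jh , _ = h , joins-incidentʳ jh , within
    where
    ¬r~β : ¬ Linked h r β
    ¬r~β r~β = noBypass jh (reverse (r~β ++ β~a))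
    escape : ∀ {v} → v ∈ₛ Branch r e → Linked h r v → UntilEdge (λ i → i ≢ h) e v r → ⊥
    escape v∈ _ (inj₁ V) = ∈-branch⁻ v∈ (reverse (weaken (λ _ → proj₂) V))
    escape v∈ r~v (inj₂ (z , iz , V)) with incident-joins j iz
    ... | inj₁ refl = ∈-branch⁻ v∈ (r~α ++ reverse (weaken (λ _ → proj₂) V))
    ... | inj₂ refl = ¬r~β (r~v ++ weaken (λ _ → proj₁) V)
    within : Branch r e ⊆ Branch r h
    within v∈ = ∈-branch⁺ λ r~v → escape v∈ r~v (untilEdge e (reverse r~v))

  branchesBeyond-smaller : ∀ {r e α β} → Joins E e α β → Linked e r α →
    n < ∣ Branch r e ∣ + ∣ Branch r e ∣ → ∀ h → Incident E h β → ∣ Branch β h ∣ < ∣ Branch r e ∣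
  branchesBeyond-smaller {r} {e} {α} {β} j r~α big h ihβ with h ≟ e
  ... | yes refl = ≤-<-trans (p⊆q⇒∣p∣≤∣q∣ behindE) (≤-<-trans (≤-reflexive (∣∁p∣≡n∸∣p∣ (Branch r e)))
                                                                (less-than-half n _ big))
    where
    -- Branch β e is the component of α, disjoint from Branch r e
    behindE : Branch β e ⊆ ∁ (Branch r e)
    behindE {v} v∈ = x∉p⇒x∈∁p λ v∈' → apart v∈' (twoSides j v)
      where
      apart : v ∈ₛ Branch r e → Linked e v α ⊎ Linked e v β → ⊥
      apart v∈' (inj₁ v~α) = ∈-branch⁻ v∈' (r~α ++ reverse v~α)
      apart v∈' (inj₂ v~β) = ∈-branch⁻ v∈ (reverse v~β)
  ... | no h≢e = p⊂q⇒∣p∣<∣q∣ (within , β , ∈-branch⁺ ¬r~β , λ β∈ → ∈-branch⁻ β∈ nil)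
    where
    ¬r~β : ¬ Linked e r β
    ¬r~β r~β = noBypass j (reverse r~α ++ r~β)
    o : Fin n
    o = proj₁ (otherEnd ihβ)
    jo : Joins E h β o
    jo = proj₂ (otherEnd ihβ)
    escape : ∀ {v} → v ∈ₛ Branch β h → Linked e r v → UntilEdge (λ i → i ≢ e) h v α → ⊥
    escape v∈ _ (inj₁ V) = ∈-branch⁻ v∈ (reverse (weaken (λ _ → proj₂) V ++ edgeLink j (≢-sym h≢e)))
    escape v∈ r~v (inj₂ (z , iz , V)) with incident-joins jo iz
    ... | inj₁ refl = ∈-branch⁻ v∈ (reverse (weaken (λ _ → proj₂) V))
    ... | inj₂ refl = ¬r~β (r~v ++ (weaken (λ _ → proj₁) V ++ edgeLink (joins-sym jo) h≢e))
    within : Branch β h ⊆ Branch r e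
    within v∈ = ∈-branch⁺ λ r~v → escape v∈ r~v (untilEdge h (reverse r~v ++ r~α))

  centroid-bound : ∀ {r e α β} → IsCentroid E r → Joins E e α β → Linked e r α →
                   ¬ (n < ∣ Branch r e ∣ + ∣ Branch r e ∣)
  centroid-bound {r} {e} {α} {β} (wr , weight-r , minimal) j r~α big
    with rootBranchAbove j r~α | weight-attained β e (joins-incidentʳ j)
  ... | h , ihr , within | hβ , ihβ , weight-β = <-irrefl refl (begin-strict
    wr              ≤⟨ minimal β _ weight-β ⟩
    ∣ Branch β hβ ∣ <⟨ branchesBeyond-smaller j r~α big hβ ihβ ⟩
    ∣ Branch r e ∣  ≤⟨ p⊆q⇒∣p∣≤∣q∣ within ⟩
    ∣ Branch r h ∣  ≤⟨ branch≤weight weight-r ihr ⟩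
    wr              ∎)
    where open ≤-Reasoning

module ThetaBranches {n m : ℕ} (E : Edges n m) (tree : IsTree E) where

  open Walks E
  open Tree E tree
  open Branches E tree

  componentSize : ∀ {e z k} (S : Subset n) → CompSize E (∁ ⁅ e ⁆) z k →
                  (∀ w → Linked e z w → w ∈ₛ S) → (∀ w → w ∈ₛ S → Linked e z w) → k ≡ ∣ S ∣
  componentSize S (C , refl , isComponent) toS fromS = cong ∣_∣ (⊆-antisym
    (λ {w} w∈ → toS w (weaken (λ _ → avoids⁻) (fromWalk (proj₁ (isComponent w) w∈))))
    (λ {w} w∈ → proj₂ (isComponent w) (toWalk (weaken (λ _ → avoids⁺) (fromS w w∈)))))
    where
    avoids⁻ : ∀ {e i : Fin m} → i ∈ₛ ∁ ⁅ e ⁆ → i ≢ e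
    avoids⁻ i∈ = x∉⁅y⁆⇒x≢y (x∈∁p⇒x∉p i∈)
    avoids⁺ : ∀ {e i : Fin m} → i ≢ e → i ∈ₛ ∁ ⁅ e ⁆
    avoids⁺ i≢e = x∉p⇒x∈∁p (x≢y⇒x∉⁅y⁆ i≢e)

  nearComponent : ∀ {r e α β k} → Joins E e α β → Linked e r α →
                  CompSize E (∁ ⁅ e ⁆) α k → k ≡ n ∸ ∣ Branch r e ∣
  nearComponent {r} {e} {α} j r~α c =
    trans (componentSize (∁ (Branch r e)) c toS fromS) (∣∁p∣≡n∸∣p∣ (Branch r e))
    where
    toS : ∀ w → Linked e α w → w ∈ₛ ∁ (Branch r e)
    toS w α~w = x∉p⇒x∈∁p λ w∈ → ∈-branch⁻ w∈ (r~α ++ α~w)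
    fromS : ∀ w → w ∈ₛ ∁ (Branch r e) → Linked e α w
    fromS w w∉ with twoSides j w
    ... | inj₁ w~α = reverse w~α
    ... | inj₂ w~β = ⊥-elim (x∈∁p⇒x∉p w∉ (∈-branch⁺ λ r~w → noBypass j (reverse r~α ++ (r~w ++ w~β))))

  farComponent : ∀ {r e α β k} → Joins E e α β → Linked e r α →
                 CompSize E (∁ ⁅ e ⁆) β k → k ≡ ∣ Branch r e ∣
  farComponent {r} {e} {α} {β} j r~α c = componentSize (Branch r e) c toS fromS
    where
    toS : ∀ w → Linked e β w → w ∈ₛ Branch r e
    toS w β~w = ∈-branch⁺ λ r~w → noBypass j (reverse r~α ++ (r~w ++ reverse β~w))
    fromS : ∀ w → w ∈ₛ Branch r e → Linked e β w
    fromS w w∈ with twoSides j w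
    ... | inj₁ w~α = ⊥-elim (∈-branch⁻ w∈ (r~α ++ reverse w~α))
    ... | inj₂ w~β = reverse w~β

  theta-branch : ∀ {r e α β p q} → Theta E e p q → Joins E e α β → Linked e r α →
                 SamePartition p q (n ∸ ∣ Branch r e ∣) ∣ Branch r e ∣
  theta-branch (cX , cY) j r~α with joins-ends j
  ... | inj₁ (refl , refl) = inj₁ (nearComponent j r~α cX , farComponent j r~α cY)
  ... | inj₂ (refl , refl) = inj₂ (farComponent j r~α cX , nearComponent j r~α cY)

module Repulsion {n m : ℕ} (E : Edges n m) (tree : IsTree E) where

  open Walks E
  open Tree E tree
  open Branches E tree
  open CentroidBound E tree
  open ThetaBranches E tree

  record Crossing (r s : Fin n) (e : Fin m) : Set where
    constructor crossing
    field
      near far  : Fin n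
      joins     : Joins E e near far
      fromStart : Linked e r near
      toEnd     : Linked e far s
  open Crossing

  crossing-reverse : ∀ {r s e} → Crossing r s e → Crossing s r e
  crossing-reverse (crossing α β j r~α β~s) = crossing β α (joins-sym j) (reverse β~s) (reverse r~α)

  crossing-separates : ∀ {r s e} → Crossing r s e → ¬ Linked e r s
  crossing-separates (crossing α β j r~α β~s) r~s = noBypass j (reverse r~α ++ (r~s ++ reverse β~s))

  traverses-fromChain : ∀ {e} v rest (chain : Chain E (v ∷ rest)) → UsesEdge E e (v ∷ rest) →
                        Σ (Fin n) λ a → Σ (Fin n) λ b → Traverses e a b (fromChain v rest chain)
  traverses-fromChain v [] _ ()
  traverses-fromChain {e} v (y ∷ rest) ((i , ji) , _) (inj₁ je) with proj₂ simple e i v y je ji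
  ... | refl = v , y , now
  traverses-fromChain v (y ∷ rest) ((i , ji) , chain) (inj₂ uses) with traverses-fromChain y rest chain uses
  ... | a , b , T = a , b , later T

  pathCrossing : ∀ {e} v rest → IsPath E (v ∷ rest) → UsesEdge E e (v ∷ rest) → Crossing v (lastOf E v rest) e
  pathCrossing v rest (unique , chain) uses with traverses-fromChain v rest chain uses
  ... | a , b , T with splitAt (fromChain v rest chain)
                      (subst Unique (sym (vertices-fromChain v rest chain)) unique) T
  ... | v~a , b~end = crossing a b (proj₁ (traversed T)) v~a b~end

  crossingOrder : ∀ {r s e₁ e₂} → e₁ ≢ e₂ → (c₁ : Crossing r s e₁) → (c₂ : Crossing r s e₂) →
                  Linked e₁ r (near c₂) → ¬ Linked e₂ r (near c₁)
  crossingOrder {e₁ = e₁} {e₂} e₁≢e₂ c₁@(crossing α₁ β₁ j₁ r~α₁ _) c₂@(crossing α₂ β₂ j₂ _ β₂~s) r~₁α₂ r~₂α₁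
    with untilEdge e₁ β₂~s
  ... | inj₁ V = crossing-separates c₁ (r~₁α₂ ++ (edgeLink j₂ (≢-sym e₁≢e₂) ++ weaken (λ _ → proj₂) V))
  ... | inj₂ (z , iz , V) with incident-joins j₁ iz
  ...   | inj₁ refl = crossing-separates c₂ (r~₂α₁ ++ (reverse (weaken (λ _ → proj₁) V) ++ β₂~s))
  ...   | inj₂ refl = noBypass j₁ (reverse r~α₁ ++ ((r~₁α₂ ++ edgeLink j₂ (≢-sym e₁≢e₂)) ++ weaken (λ _ → proj₂) V))

  branch-nested : ∀ {r s e₁ e₂} → e₁ ≢ e₂ → (c₂ : Crossing r s e₂) → ¬ Linked e₁ r (near c₂) →
                  Branch r e₂ ⊂ Branch r e₁
  branch-nested {r} {e₁ = e₁} {e₂} e₁≢e₂ (crossing α₂ β₂ j₂ r~α₂ _) ¬r~α₂ =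
    within , α₂ , ∈-branch⁺ ¬r~α₂ , (λ α₂∈ → ∈-branch⁻ α₂∈ r~α₂)
    where
    escape : ∀ {v} → v ∈ₛ Branch r e₂ → UntilEdge (λ i → i ≢ e₁) e₂ r v → ⊥
    escape v∈ (inj₁ V) = ∈-branch⁻ v∈ (weaken (λ _ → proj₂) V)
    escape v∈ (inj₂ (z , iz , V)) with incident-joins j₂ iz
    ... | inj₁ refl = ¬r~α₂ (weaken (λ _ → proj₁) V)
    ... | inj₂ refl = ¬r~α₂ (weaken (λ _ → proj₁) V ++ edgeLink (joins-sym j₂) (≢-sym e₁≢e₂))
    within : Branch r e₂ ⊆ Branch r e₁
    within v∈ = ∈-branch⁺ λ r~v → escape v∈ (untilEdge e₂ r~v)

  branches-nested : ∀ {r s e₁ e₂} → e₁ ≢ e₂ → (c₁ : Crossing r s e₁) → (c₂ : Crossing r s e₂) →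
                    Branch r e₂ ⊂ Branch r e₁ ⊎ Branch r e₁ ⊂ Branch r e₂
  branches-nested {r} {e₁ = e₁} e₁≢e₂ c₁ c₂ with linked? e₁ r (near c₂)
  ... | no ¬r~α₂ = inj₁ (branch-nested e₁≢e₂ c₂ ¬r~α₂)
  ... | yes r~α₂ = inj₂ (branch-nested (≢-sym e₁≢e₂) c₁ (crossingOrder e₁≢e₂ c₁ c₂ r~α₂))

  equalTheta⇒large : ∀ {r s e₁ e₂ p q p' q'} → (c₁ : Crossing r s e₁) → (c₂ : Crossing r s e₂) →
    Theta E e₁ p q → Theta E e₂ p' q' → SamePartition p q p' q' →
    Branch r e₂ ⊂ Branch r e₁ → n < ∣ Branch r e₁ ∣ + ∣ Branch r e₁ ∣
  equalTheta⇒large {r} {e₂ = e₂} c₁ c₂ θ₁ θ₂ same nested =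
    unequal-halves (p⊂q⇒∣p∣<∣q∣ nested) (∣p∣≤n (Branch r e₂))
      (samePartition-trans (samePartition-sym (theta-branch θ₁ (joins c₁) (fromStart c₁)))
        (samePartition-trans same (theta-branch θ₂ (joins c₂) (fromStart c₂))))

  crossings-repel : ∀ {r s e₁ e₂ p q p' q'} → IsCentroid E r → e₁ ≢ e₂ →
    Crossing r s e₁ → Crossing r s e₂ → Theta E e₁ p q → Theta E e₂ p' q' → SamePartition p q p' q' → ⊥
  crossings-repel centroid e₁≢e₂ c₁ c₂ θ₁ θ₂ same with branches-nested e₁≢e₂ c₁ c₂
  ... | inj₁ nested = centroid-bound centroid (joins c₁) (fromStart c₁) (equalTheta⇒large c₁ c₂ θ₁ θ₂ same nested)
  ... | inj₂ nested = centroid-bound centroid (joins c₂) (fromStart c₂)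
                        (equalTheta⇒large c₂ c₁ θ₂ θ₁ (samePartition-sym same) nested)

-- Corollary 5.5.  A path attracting ea and eb starts (after reversal if needed) at a
-- centroid and crosses both edges, which is impossible when θ(ea) = θ(eb).
corollary5p5 : {n m : ℕ} (E : Edges n m) → IsTree E →
    (ea eb : Fin m) → ea ≢ eb →
    (p q p' q' : ℕ) → Theta E ea p q → Theta E eb p' q' →
    SamePartition p q p' q' → Repel E ea eb
corollary5p5 E tree ea eb ea≢eb p q p' q' θa θb same (v₀ , rest , path , usesA , usesB , centroidEnd) =
  repel centroidEnd
  where
  open Repulsion E tree
  crossA : Crossing v₀ (lastOf E v₀ rest) ea
  crossA = pathCrossing v₀ rest path usesA
  crossB : Crossing v₀ (lastOf E v₀ rest) eb
  crossB = pathCrossing v₀ rest path usesB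
  repel : IsCentroid E v₀ ⊎ IsCentroid E (lastOf E v₀ rest) → ⊥
  repel (inj₁ start) = crossings-repel start ea≢eb crossA crossB θa θb same
  repel (inj₂ end) = crossings-repel end ea≢eb (crossing-reverse crossA) (crossing-reverse crossB) θa θb same
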